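{- Let $A$ be a multiplicative divisor system. Then there exists an arithmetical function $\phi_A:\mathbb N\to\mathbb C$ satisfying $$\sum_{d\in A(n)}\phi_A(d)=n\quad\text{for all } n\ge1$$ if and only if $n\in A(n)$ for all $n\in\mathbb N$. In this case the solution $\phi_A$ is unique, is multiplicative, and satisfies $1\le\phi_A(n)\le n$ for all $n\in\mathbb N$.
   Context: A divisor system $A$ assigns to each positive integer $n$ a set $A(n)$ of positive divisors of $n$. It is called multiplicative if not all $A(n)$ are empty and $A(n_1n_2)=A(n_1)A(n_2)=\{d_1d_2: d_1\in A(n_1),d_2\in A(n_2)\}$ whenever $\gcd(n_1,n_2)=1$. -}

module Defs where

open import Level using (Level)
open import Data.Bool using (Bool; true; false; T; if_then_else_)
open import Data.Nat using (ℕ; zero; suc; _*_; _≤_)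
open import Data.Nat.Divisibility using (_∣_)
open import Data.Nat.Coprimality using (Coprime)
open import Data.Product using (Σ; ∃; _×_)
open import Relation.Binary.PropositionalEquality using (_≡_)
open import Algebra.Bundles using (CommutativeRing)

-- The value of mem at n = 0 is irrelevant (the domain is the positive integers).
record DivisorSystem : Set where
  field
    mem    : ℕ → ℕ → Bool
    memDiv : ∀ n d → 1 ≤ n → T (mem n d) → d ∣ n

open DivisorSystem public

record IsMultiplicativeDS (A : DivisorSystem) : Set where
  field
    nonempty : Σ ℕ λ n → Σ ℕ λ d → 1 ≤ n × T (mem A n d)
    mult⇒    : ∀ n₁ n₂ d → 1 ≤ n₁ → 1 ≤ n₂ → Coprime n₁ n₂ →
               T (mem A (n₁ * n₂) d) →
               Σ ℕ λ d₁ → Σ ℕ λ d₂ → T (mem A n₁ d₁) × T (mem A n₂ d₂) × d ≡ d₁ * d₂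
    mult⇐    : ∀ n₁ n₂ d₁ d₂ → 1 ≤ n₁ → 1 ≤ n₂ → Coprime n₁ n₂ →
               T (mem A n₁ d₁) → T (mem A n₂ d₂) → T (mem A (n₁ * n₂) (d₁ * d₂))

module _ {c ℓ : Level} (R : CommutativeRing c ℓ) where
  open CommutativeRing R renaming (_*_ to _*R_)

  ι : ℕ → Carrier
  ι zero    = 0#
  ι (suc n) = 1# + ι n

  CharZero : Set ℓ
  CharZero = ∀ m n → ι m ≈ ι n → m ≡ n

  partialSum : DivisorSystem → (ℕ → Carrier) → ℕ → ℕ → Carrier
  partialSum A φ n zero    = 0#
  partialSum A φ n (suc k) =
    partialSum A φ n k + (if mem A n (suc k) then φ (suc k) else 0#)

  -- Σ_{d ∈ A(n)} φ(d)   (all elements of A(n) lie in {1,…,n} for n ≥ 1)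
  divisorSum : DivisorSystem → (ℕ → Carrier) → ℕ → Carrier
  divisorSum A φ n = partialSum A φ n n

  IsSolution : DivisorSystem → (ℕ → Carrier) → Set ℓ
  IsSolution A φ = ∀ n → 1 ≤ n → divisorSum A φ n ≈ ι n

  IsMultiplicativeFn : (ℕ → Carrier) → Set ℓ
  IsMultiplicativeFn φ =
    (φ 1 ≈ 1#) ×
    (∀ m n → 1 ≤ m → 1 ≤ n → Coprime m n → φ (m * n) ≈ φ m *R φ n)

{-# OPTIONS --safe #-}

-- Define φ : ℕ → ℕ by the recursion φ n = n − Σ_{d ∈ A(n), d < n} φ d that the equation forces
-- when n ∈ A(n).  By strong induction, φ is multiplicative and its proper sum at n is < n, so
-- 1 ≤ φ n ≤ n.  If n is a prime power, its divisors form a chain, so each proper divisor in A(n)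
-- is at most half of the next and, as φ ≤ id, the proper sum is < n.  If n = ab with a, b > 1
-- coprime, then A(n) = A(a)A(b) and multiplicativity of φ below n give
-- Σ_{d ∈ A(n), d < n} φ d + φ a φ b = (Σ_{A(a)} φ)(Σ_{A(b)} φ) = ab = n.
-- Conversely, in characteristic zero a solution forces n ∈ A(n): multiplicativity of A reduces
-- this to prime powers, and for a prime power n ∉ A(n) the equation would equate the proper sum,
-- which is < n, with n.  Any solution agrees with φ, by induction, cancelling the proper sum.
module Submission where

open import Defs
open import Level using (Level)
open import Algebra.Bundles using (CommutativeRing)
open import Data.Bool using (true; false; T; if_then_else_)
open import Data.Unit using (tt)
open import Data.Nat
open import Data.Nat.Properties
open import Data.Nat.Divisibility
open import Data.Nat.Coprimality using (Coprime; coprime-divisor)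
import Data.Nat.Coprimality as Coprimality
open import Data.Nat.Primality using (Prime; prime⇒irreducible; prime⇒nonZero; prime⇒nonTrivial)
open import Data.Nat.Primality.Factorisation using (factorise)
open import Data.Nat.Induction using (<-rec)
open import Data.Nat.ListAction using (sum; product)
open import Data.Nat.ListAction.Properties using (sum-++; sum-↭)
open import Data.List using (List; []; _∷_; _++_; map; filterᵇ; applyDownFrom; cartesianProduct)
open import Data.List.Properties using (map-++; map-∘; map-cong-local)
open import Data.List.Membership.Propositional using (_∈_)
open import Data.List.Membership.Propositional.Properties
  using (∈-filter⁺; ∈-filter⁻; ∈-applyDownFrom⁺; ∈-applyDownFrom⁻; ∈-map⁺; ∈-map⁻;
         ∈-cartesianProduct⁺; ∈-cartesianProduct⁻)
open import Data.List.Membership.Propositional.Properties.WithK using (unique∧set⇒bag)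
open import Data.List.Relation.Unary.Any using (here; there)
open import Data.List.Relation.Unary.All using (All; []; _∷_)
import Data.List.Relation.Unary.All as All
import Data.List.Relation.Unary.All.Properties as All
open import Data.List.Relation.Unary.AllPairs using (AllPairs; []; _∷_)
import Data.List.Relation.Unary.AllPairs as AllPairs
import Data.List.Relation.Unary.AllPairs.Properties as AllPairs
open import Data.List.Relation.Unary.Unique.Propositional using (Unique)
open import Data.List.Relation.Unary.Unique.Propositional.Properties using (cartesianProduct⁺)
open import Data.List.Relation.Binary.Permutation.Propositional using (_↭_)
import Data.List.Relation.Binary.Permutation.Propositional.Properties as ↭
open import Data.List.Relation.Binary.BagAndSetEquality using (∼bag⇒↭)
open import Data.Product using (Σ; ∃; ∃₂; _×_; _,_; proj₁; proj₂; uncurry)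
open import Data.Sum using (_⊎_; inj₁; inj₂)
open import Function using (_∘_; _⇔_; mk⇔)
open import Relation.Nullary using (¬_; yes; no; contradiction)
open import Relation.Nullary.Decidable using (T?; does; dec-true; dec-false)
open import Relation.Binary.PropositionalEquality
  using (_≡_; _≢_; refl; sym; trans; cong; cong₂; subst; module ≡-Reasoning)

private variable
  a b c d m n x y : ℕ

∣⇒>0 : 0 < n → m ∣ n → 0 < m
∣⇒>0 0<n m∣n = n≢0⇒n>0 λ { refl → <⇒≢ 0<n (sym (0∣⇒≡0 m∣n)) }

m∣n∧m<n⇒2*m≤n : m ∣ n → m < n → 2 * m ≤ n
m∣n∧m<n⇒2*m≤n     (divides 0 refl) ()
m∣n∧m<n⇒2*m≤n {m} (divides 1 refl) m<m = contradiction m<m (<-irrefl (sym (+-identityʳ m)))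
m∣n∧m<n⇒2*m≤n {m} (divides (2+ q) refl) _ = +-monoʳ-≤ m (+-monoʳ-≤ m z≤n)

factors< : a * b ≡ n → 1 < a → 1 < b → a < n × b < n
factors< {a} {b} refl 1<a 1<b =
  m<m*n a b {{>-nonZero (<⇒≤ 1<a)}} 1<b ,
  subst (b <_) (*-comm b a) (m<m*n b a {{>-nonZero (<⇒≤ 1<b)}} 1<a)

UpTo : ∀ {p} → (ℕ → Set p) → ℕ → Set p
UpTo P n = ∀ {m} → 1 ≤ m → m ≤ n → P m

UpTo-≤ : ∀ {p} {P : ℕ → Set p} → m ≤ n → UpTo P n → UpTo P m
UpTo-≤ m≤n P≤n 1≤k k≤m = P≤n 1≤k (≤-trans k≤m m≤n)

MultiplicativeAt : (ℕ → ℕ) → ℕ → Set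
MultiplicativeAt h n = ∀ {a b} → a * b ≡ n → Coprime a b → h n ≡ h a * h b

_[_≔_] : (ℕ → ℕ) → ℕ → ℕ → ℕ → ℕ
(h [ n ≔ v ]) d = if does (d ≟ n) then v else h d

update-≡ : ∀ h n v → (h [ n ≔ v ]) n ≡ v
update-≡ h n v rewrite dec-true (n ≟ n) refl = refl

update-≢ : ∀ h v → d ≢ n → (h [ n ≔ v ]) d ≡ h d
update-≢ {d} {n} h v d≢n rewrite dec-false (d ≟ n) d≢n = refl

coprime-divisors : Coprime a b → c ∣ a → d ∣ b → Coprime c d
coprime-divisors coprime c∣a d∣b (e∣c , e∣d) = coprime (∣-trans e∣c c∣a , ∣-trans e∣d d∣b)

module _ {a b x₁ y₁ x₂ y₂ : ℕ} (coprime : Coprime a b)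
         (x₁∣a : x₁ ∣ a) (y₁∣b : y₁ ∣ b) (x₂∣a : x₂ ∣ a) (y₂∣b : y₂ ∣ b) where

  coprimeFactors-∣ : x₁ * y₁ ≡ x₂ * y₂ → x₁ ∣ x₂ × y₁ ∣ y₂
  coprimeFactors-∣ eq =
    coprime-divisor (coprime-divisors coprime x₁∣a y₂∣b) (subst (x₁ ∣_) (trans eq (*-comm x₂ y₂)) (m∣m*n y₁)) ,
    coprime-divisor (coprime-divisors (Coprimality.sym coprime) y₁∣b x₂∣a) (subst (y₁ ∣_) eq (n∣m*n x₁))

coprimeFactors-unique : ∀ {x₁ y₁ x₂ y₂} → Coprime a b → x₁ ∣ a → y₁ ∣ b → x₂ ∣ a → y₂ ∣ b →
                        x₁ * y₁ ≡ x₂ * y₂ → x₁ ≡ x₂ × y₁ ≡ y₂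
coprimeFactors-unique coprime x₁∣a y₁∣b x₂∣a y₂∣b eq =
  let x₁∣x₂ , y₁∣y₂ = coprimeFactors-∣ coprime x₁∣a y₁∣b x₂∣a y₂∣b eq
      x₂∣x₁ , y₂∣y₁ = coprimeFactors-∣ coprime x₂∣a y₂∣b x₁∣a y₁∣b (sym eq)
  in ∣-antisym x₁∣x₂ x₂∣x₁ , ∣-antisym y₁∣y₂ y₂∣y₁

DivisorChain : ℕ → Set
DivisorChain n = ∀ {x y} → x ∣ n → y ∣ n → x ∣ y ⊎ y ∣ x

CoprimeSplit : ℕ → Set
CoprimeSplit n = ∃₂ λ a b → 1 < a × 1 < b × a * b ≡ n × Coprime a b

sum-decreasingDivisors< : 0 < m → DivisorChain m → {xs : List ℕ} →
                          All (λ x → x ∣ m × x < m) xs → AllPairs _>_ xs → sum xs < m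
sum-decreasingDivisors< 0<m chain [] [] = 0<m
sum-decreasingDivisors< {m} 0<m chain {x ∷ xs} ((x∣m , x<m) ∷ below) (x>xs ∷ decreasing) =
  begin-strict
    x + sum xs  <⟨ +-monoʳ-< x (sum-decreasingDivisors< (∣⇒>0 0<m x∣m) chainₓ belowₓ decreasing) ⟩
    x + x       ≡⟨ cong (x +_) (+-identityʳ x) ⟨
    2 * x       ≤⟨ m∣n∧m<n⇒2*m≤n x∣m x<m ⟩
    m           ∎
  where
  open ≤-Reasoning
  chainₓ : DivisorChain x
  chainₓ y∣x z∣x = chain (∣-trans y∣x x∣m) (∣-trans z∣x x∣m)
  properDivisor : ∀ {y} → y ∣ m × y < m → x > y → y ∣ x × y < x
  properDivisor (y∣m , _) y<x with chain y∣m x∣m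
  ... | inj₁ y∣x = y∣x , y<x
  ... | inj₂ x∣y = contradiction (∣⇒≤ {{>-nonZero (∣⇒>0 0<m y∣m)}} x∣y) (<⇒≱ y<x)
  belowₓ : All (λ y → y ∣ x × y < x) xs
  belowₓ = All.zipWith (uncurry properDivisor) (below , x>xs)

module _ {p : ℕ} (p-prime : Prime p) where

  private instance
    p≢0 : NonZero p
    p≢0 = prime⇒nonZero p-prime

  1<p : 1 < p
  1<p = nonTrivial⇒n>1 p {{prime⇒nonTrivial p-prime}}

  ∤⇒coprime : ¬ p ∣ m → Coprime m p
  ∤⇒coprime p∤m (d∣m , d∣p) with prime⇒irreducible p-prime d∣p
  ... | inj₁ d≡1  = d≡1
  ... | inj₂ refl = contradiction d∣m p∤m

  ∣p^k⇒≡p^i : ∀ k → d ∣ p ^ k → ∃ λ i → d ≡ p ^ i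
  ∣p^k⇒≡p^i zero d∣1 = 0 , ∣1⇒≡1 d∣1
  ∣p^k⇒≡p^i {d} (suc k) d∣p^k+1 with p ∣? d
  ... | no p∤d = ∣p^k⇒≡p^i k (coprime-divisor (∤⇒coprime p∤d) d∣p^k+1)
  ... | yes (divides q refl)
    with ∣p^k⇒≡p^i k (*-cancelˡ-∣ p (subst (_∣ p ^ suc k) (*-comm q p) d∣p^k+1))
  ...   | i , refl = suc i , *-comm (p ^ i) p

  p^i∣p^j : ∀ {i j} → i ≤ j → p ^ i ∣ p ^ j
  p^i∣p^j {i} {j} i≤j = divides (p ^ (j ∸ i)) (begin
    p ^ j               ≡⟨ cong (p ^_) (m+[n∸m]≡n i≤j) ⟨
    p ^ (i + (j ∸ i))   ≡⟨ ^-distribˡ-+-* p i (j ∸ i) ⟩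
    p ^ i * p ^ (j ∸ i) ≡⟨ *-comm (p ^ i) _ ⟩
    p ^ (j ∸ i) * p ^ i ∎)
    where open ≡-Reasoning

  p^k-divisorChain : ∀ k → DivisorChain (p ^ k)
  p^k-divisorChain k x∣p^k y∣p^k with ∣p^k⇒≡p^i k x∣p^k | ∣p^k⇒≡p^i k y∣p^k
  ... | i , refl | j , refl with ≤-total i j
  ... | inj₁ i≤j = inj₁ (p^i∣p^j i≤j)
  ... | inj₂ j≤i = inj₂ (p^i∣p^j j≤i)

  ∤⇒coprime-p^k : ∀ k → ¬ p ∣ m → Coprime (p ^ k) m
  ∤⇒coprime-p^k k p∤m (d∣p^k , d∣m) with ∣p^k⇒≡p^i k d∣p^k
  ... | zero  , d≡1  = d≡1
  ... | suc i , refl = contradiction (∣-trans (m∣m*n (p ^ i)) d∣m) p∤m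

  p-adicSplit : ∀ n → 0 < n → ∃₂ λ k m → n ≡ p ^ k * m × ¬ p ∣ m
  p-adicSplit = <-rec _ split
    where
    split : ∀ n → (∀ {m} → m < n → 0 < m → ∃₂ λ k r → m ≡ p ^ k * r × ¬ p ∣ r) →
            0 < n → ∃₂ λ k m → n ≡ p ^ k * m × ¬ p ∣ m
    split n rec 0<n with p ∣? n
    ... | no p∤n = 0 , n , sym (*-identityˡ n) , p∤n
    ... | yes (divides q refl) with rec (m<m*n q p {{>-nonZero 0<q}} 1<p) 0<q
      where
      0<q : 0 < q
      0<q = ∣⇒>0 0<n (m∣m*n p)
    ...   | k , r , refl , p∤r = suc k , r , reassociate , p∤r
      where
      reassociate : p ^ k * r * p ≡ p * p ^ k * r
      reassociate = begin
        p ^ k * r * p   ≡⟨ *-assoc (p ^ k) r p ⟩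
        p ^ k * (r * p) ≡⟨ cong (p ^ k *_) (*-comm r p) ⟩
        p ^ k * (p * r) ≡⟨ *-assoc (p ^ k) p r ⟨
        p ^ k * p * r   ≡⟨ cong (_* r) (*-comm (p ^ k) p) ⟩
        p * p ^ k * r   ∎
        where open ≡-Reasoning

primeFactor : 1 < n → ∃ λ p → Prime p × p ∣ n
primeFactor {n} 1<n with factorise n {{>-nonZero (<⇒≤ 1<n)}}
... | record { factors = [] ; isFactorisation = refl } = contradiction 1<n (<-irrefl refl)
... | record { factors = p ∷ ps ; isFactorisation = refl ; factorsPrime = p-prime ∷ _ } =
  p , p-prime , m∣m*n (product ps)

divisorChain⊎coprimeSplit : 1 < n → DivisorChain n ⊎ CoprimeSplit n
divisorChain⊎coprimeSplit {n} 1<n with primeFactor 1<n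
... | p , p-prime , p∣n with p-adicSplit p-prime n (<⇒≤ 1<n)
... | zero  , m , refl , p∤m = contradiction (subst (p ∣_) (+-identityʳ m) p∣n) p∤m
... | suc k , 0 , refl , _   = contradiction (subst (1 <_) (*-zeroʳ (p ^ suc k)) 1<n) λ ()
... | suc k , 1 , refl , _   =
  inj₁ (subst DivisorChain (sym (*-identityʳ (p ^ suc k))) (p^k-divisorChain p-prime (suc k)))
... | suc k , m@(2+ _) , refl , p∤m =
  inj₂ (p ^ suc k , m , ^-monoʳ-< p (1<p p-prime) {0} {suc k} z<s , s<s z<s , refl ,
        ∤⇒coprime-p^k p-prime (suc k) p∤m)

module _ {ℓ₁ ℓ₂ : Level} {X : Set ℓ₁} {Y : Set ℓ₂} where

  map⁺-injectiveOn : ∀ (f : X → Y) {xs} → (∀ {x y} → x ∈ xs → y ∈ xs → f x ≡ f y → x ≡ y) →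
                     Unique xs → Unique (map f xs)
  map⁺-injectiveOn f _ [] = []
  map⁺-injectiveOn f injective (x∉xs ∷ unique) =
    All.map⁺ (All.tabulate λ y∈xs fx≡fy → All.lookup x∉xs y∈xs (injective (here refl) (there y∈xs) fx≡fy))
    ∷ map⁺-injectiveOn f (λ x∈ y∈ → injective (there x∈) (there y∈)) unique

  *-distribˡ-sum : ∀ c (h : Y → ℕ) ys → c * sum (map h ys) ≡ sum (map (λ y → c * h y) ys)
  *-distribˡ-sum c h []       = *-zeroʳ c
  *-distribˡ-sum c h (y ∷ ys) = trans (*-distribˡ-+ c (h y) _) (cong (c * h y +_) (*-distribˡ-sum c h ys))

  sum-map-cartesianProduct-* : ∀ (u : X → ℕ) (v : Y → ℕ) xs ys →
    sum (map (λ (x , y) → u x * v y) (cartesianProduct xs ys)) ≡ sum (map u xs) * sum (map v ys)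
  sum-map-cartesianProduct-* u v []       ys = refl
  sum-map-cartesianProduct-* u v (x ∷ xs) ys = begin
    sum (map uv (map (x ,_) ys ++ cartesianProduct xs ys))
      ≡⟨ cong sum (map-++ uv (map (x ,_) ys) _) ⟩
    sum (map uv (map (x ,_) ys) ++ map uv (cartesianProduct xs ys))
      ≡⟨ sum-++ (map uv (map (x ,_) ys)) _ ⟩
    sum (map uv (map (x ,_) ys)) + sum (map uv (cartesianProduct xs ys))
      ≡⟨ cong₂ _+_ (cong sum (sym (map-∘ ys))) (sum-map-cartesianProduct-* u v xs ys) ⟩
    sum (map (λ y → u x * v y) ys) + sum (map u xs) * sum (map v ys)
      ≡⟨ cong (_+ _) (*-distribˡ-sum (u x) v ys) ⟨
    u x * sum (map v ys) + sum (map u xs) * sum (map v ys)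
      ≡⟨ *-distribʳ-+ (sum (map v ys)) (u x) _ ⟨
    (u x + sum (map u xs)) * sum (map v ys) ∎
    where
    open ≡-Reasoning
    uv : X × Y → ℕ
    uv (x , y) = u x * v y

unique∧set⇒↭ : ∀ {ℓ} {X : Set ℓ} {xs ys : List X} →
               Unique xs → Unique ys → (∀ {x} → x ∈ xs ⇔ x ∈ ys) → xs ↭ ys
unique∧set⇒↭ unique-xs unique-ys same = ∼bag⇒↭ (unique∧set⇒bag unique-xs unique-ys same)

sum-map-≤ : ∀ {f : ℕ → ℕ} → (∀ x → f x ≤ x) → ∀ xs → sum (map f xs) ≤ sum xs
sum-map-≤ f≤id []       = z≤n
sum-map-≤ f≤id (x ∷ xs) = +-mono-≤ (f≤id x) (sum-map-≤ f≤id xs)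

module Members (A : DivisorSystem) where

  Reflexive : Set
  Reflexive = ∀ n → 1 ≤ n → T (mem A n n)

  ReflexiveUpTo : ℕ → Set
  ReflexiveUpTo = UpTo λ m → T (mem A m m)

  membersUpTo : ℕ → ℕ → List ℕ
  membersUpTo n k = filterᵇ (mem A n) (applyDownFrom suc k)

  members properMembers : ℕ → List ℕ
  members       n = membersUpTo n n
  properMembers n = membersUpTo n (pred n)

  ∈-membersUpTo⁻ : ∀ {n k d} → d ∈ membersUpTo n k → (1 ≤ d × d ≤ k) × T (mem A n d)
  ∈-membersUpTo⁻ {n} {k} d∈ with ∈-filter⁻ (T? ∘ mem A n) {xs = applyDownFrom suc k} d∈
  ... | d∈range , d∈A with ∈-applyDownFrom⁻ suc d∈range
  ...   | _ , i<k , refl = (s≤s z≤n , i<k) , d∈A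

  ∈-membersUpTo⁺ : ∀ {n k d} → 1 ≤ d → d ≤ k → T (mem A n d) → d ∈ membersUpTo n k
  ∈-membersUpTo⁺ {n} (s≤s {n = i} z≤n) i<k d∈A = ∈-filter⁺ (T? ∘ mem A n) (∈-applyDownFrom⁺ suc i<k) d∈A

  ∈-members⁺ : ∀ {n d} → 1 ≤ n → T (mem A n d) → d ∈ members n
  ∈-members⁺ {n} {d} 1≤n d∈A = ∈-membersUpTo⁺ (∣⇒>0 1≤n d∣n) (∣⇒≤ {{>-nonZero 1≤n}} d∣n) d∈A
    where d∣n = memDiv A n d 1≤n d∈A

  ∈-members⁻ : ∀ {n d} → d ∈ members n → T (mem A n d)
  ∈-members⁻ {n} = proj₂ ∘ ∈-membersUpTo⁻ {n} {n}

  ∈-members⇒∣ : ∀ {n d} → 1 ≤ n → d ∈ members n → d ∣ n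
  ∈-members⇒∣ {n} {d} 1≤n d∈ = memDiv A n d 1≤n (∈-members⁻ {n} d∈)

  ∈-members⇒≤ : ∀ {n d} → d ∈ members n → d ≤ n
  ∈-members⇒≤ {n} = proj₂ ∘ proj₁ ∘ ∈-membersUpTo⁻ {n} {n}

  ∈-properMembers⇒< : ∀ {n d} → d ∈ properMembers n → d < n
  ∈-properMembers⇒< {suc n} d∈ = s≤s (proj₂ (proj₁ (∈-membersUpTo⁻ {suc n} {n} d∈)))

  membersUpTo-decreasing : ∀ n k → AllPairs _>_ (membersUpTo n k)
  membersUpTo-decreasing n k = AllPairs.filter⁺ (T? ∘ mem A n) (AllPairs.applyDownFrom⁺₁ suc k λ j<i _ → s≤s j<i)

  membersUpTo-unique : ∀ n k → Unique (membersUpTo n k)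
  membersUpTo-unique n k = AllPairs.map >⇒≢ (membersUpTo-decreasing n k)

  members-split : 1 ≤ n → T (mem A n n) → members n ≡ n ∷ properMembers n
  members-split {suc n} _ n∈A with mem A (suc n) (suc n)
  ... | true = refl

module Candidate (A : DivisorSystem) where
  open Members A

  properSum : (ℕ → ℕ) → ℕ → ℕ
  properSum h n = sum (map h (properMembers n))

  properSum-cong : ∀ n {h h′} → (∀ {d} → d < n → h d ≡ h′ d) → properSum h n ≡ properSum h′ n
  properSum-cong n h≡h′ = cong sum (map-cong-local (All.tabulate (h≡h′ ∘ ∈-properMembers⇒< {n})))

  -- Course-of-values recursion φℕ n = n ∸ properSum φℕ n (φℕ-unfold), run on fuel.  The
  -- subtraction truncates, so φℕ solves the equation at n only once properSum φℕ n ≤ n is known.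
  φFuel : ℕ → ℕ → ℕ
  φFuel zero    n = 0
  φFuel (suc f) n = n ∸ properSum (φFuel f) n

  φℕ : ℕ → ℕ
  φℕ n = φFuel (suc n) n

  φFuel-stable : ∀ {f f′} → n < f → n < f′ → φFuel f n ≡ φFuel f′ n
  φFuel-stable {n} {suc f} {suc f′} (s≤s n≤f) (s≤s n≤f′) =
    cong (n ∸_) (properSum-cong n λ d<n → φFuel-stable (<-≤-trans d<n n≤f) (<-≤-trans d<n n≤f′))

  φℕ-unfold : ∀ n → φℕ n ≡ n ∸ properSum φℕ n
  φℕ-unfold n = cong (n ∸_) (properSum-cong n λ {d} d<n → φFuel-stable {d} d<n (n<1+n d))

  φℕ≤id : ∀ n → φℕ n ≤ n
  φℕ≤id n = subst (_≤ n) (sym (φℕ-unfold n)) (m∸n≤m n (properSum φℕ n))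

  φℕ>0 : properSum φℕ n < n → 0 < φℕ n
  φℕ>0 {n} small = subst (0 <_) (sym (φℕ-unfold n)) (m<n⇒0<n∸m small)

  sum-φℕ-members : 1 ≤ n → T (mem A n n) → properSum φℕ n ≤ n → sum (map φℕ (members n)) ≡ n
  sum-φℕ-members {n} 1≤n n∈A bounded = begin
    sum (map φℕ (members n))              ≡⟨ cong (sum ∘ map φℕ) (members-split 1≤n n∈A) ⟩
    φℕ n + properSum φℕ n                 ≡⟨ cong (_+ properSum φℕ n) (φℕ-unfold n) ⟩
    n ∸ properSum φℕ n + properSum φℕ n   ≡⟨ m∸n+n≡m bounded ⟩
    n                                     ∎
    where open ≡-Reasoning

  properSum<-divisorChain : 1 ≤ n → DivisorChain n → properSum φℕ n < n
  properSum<-divisorChain {n} 1≤n chain = begin-strict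
    properSum φℕ n         ≤⟨ sum-map-≤ φℕ≤id (properMembers n) ⟩
    sum (properMembers n)  <⟨ sum-decreasingDivisors< 1≤n chain properDivisors (membersUpTo-decreasing n (pred n)) ⟩
    n                      ∎
    where
    open ≤-Reasoning
    properDivisors : All (λ d → d ∣ n × d < n) (properMembers n)
    properDivisors = All.tabulate λ {d} d∈ →
      memDiv A n d 1≤n (proj₂ (∈-membersUpTo⁻ {n} {pred n} d∈)) , ∈-properMembers⇒< {n} d∈

module Multiplicative (A : DivisorSystem) (MA : IsMultiplicativeDS A) where
  open Members A
  open Candidate A
  open IsMultiplicativeDS MA

  members-*-↭ : 1 ≤ a → 1 ≤ b → Coprime a b →
                members (a * b) ↭ map (uncurry _*_) (cartesianProduct (members a) (members b))
  members-*-↭ {a} {b} 1≤a 1≤b coprime = unique∧set⇒↭ (membersUpTo-unique (a * b) (a * b))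
    (map⁺-injectiveOn (uncurry _*_) injective (cartesianProduct⁺ (membersUpTo-unique a a) (membersUpTo-unique b b)))
    (mk⇔ to from)
    where
    factors∣ : ∀ {x y} → (x , y) ∈ cartesianProduct (members a) (members b) → x ∣ a × y ∣ b
    factors∣ xy∈ with ∈-cartesianProduct⁻ (members a) (members b) xy∈
    ... | x∈ , y∈ = ∈-members⇒∣ 1≤a x∈ , ∈-members⇒∣ 1≤b y∈
    injective : ∀ {p q} → p ∈ _ → q ∈ _ → uncurry _*_ p ≡ uncurry _*_ q → p ≡ q
    injective p∈ q∈ eq with factors∣ p∈ | factors∣ q∈
    ... | x₁∣a , y₁∣b | x₂∣a , y₂∣b =
      let x₁≡x₂ , y₁≡y₂ = coprimeFactors-unique coprime x₁∣a y₁∣b x₂∣a y₂∣b eq in cong₂ _,_ x₁≡x₂ y₁≡y₂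
    to : d ∈ members (a * b) → d ∈ map (uncurry _*_) (cartesianProduct (members a) (members b))
    to {d} d∈ with mult⇒ a b d 1≤a 1≤b coprime (∈-members⁻ {a * b} d∈)
    ... | x , y , x∈A , y∈A , refl =
      ∈-map⁺ (uncurry _*_) (∈-cartesianProduct⁺ (∈-members⁺ 1≤a x∈A) (∈-members⁺ 1≤b y∈A))
    from : d ∈ map (uncurry _*_) (cartesianProduct (members a) (members b)) → d ∈ members (a * b)
    from d∈ with ∈-map⁻ (uncurry _*_) d∈
    ... | (x , y) , xy∈ , refl with ∈-cartesianProduct⁻ (members a) (members b) xy∈
    ...   | x∈ , y∈ = ∈-members⁺ (*-mono-≤ 1≤a 1≤b)
                        (mult⇐ a b x y 1≤a 1≤b coprime (∈-members⁻ {a} x∈) (∈-members⁻ {b} y∈))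

  sum-members-* : 1 ≤ a → 1 ≤ b → Coprime a b → ∀ h →
                  (∀ {x y} → x ∈ members a → y ∈ members b → h (x * y) ≡ h x * h y) →
                  sum (map h (members (a * b))) ≡ sum (map h (members a)) * sum (map h (members b))
  sum-members-* {a} {b} 1≤a 1≤b coprime h h-* = begin
    sum (map h (members (a * b)))            ≡⟨ sum-↭ (↭.map⁺ h (members-*-↭ 1≤a 1≤b coprime)) ⟩
    sum (map h (map (uncurry _*_) pairs))    ≡⟨ cong sum (map-∘ pairs) ⟨
    sum (map (h ∘ uncurry _*_) pairs)        ≡⟨ cong sum (map-cong-local (All.tabulate h-*-pairs)) ⟩
    sum (map (λ (x , y) → h x * h y) pairs)  ≡⟨ sum-map-cartesianProduct-* h h (members a) (members b) ⟩
    sum (map h (members a)) * sum (map h (members b)) ∎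
    where
    open ≡-Reasoning
    pairs : List (ℕ × ℕ)
    pairs = cartesianProduct (members a) (members b)
    h-*-pairs : ∀ {p} → p ∈ pairs → h (uncurry _*_ p) ≡ h (proj₁ p) * h (proj₂ p)
    h-*-pairs xy∈ = uncurry h-* (∈-cartesianProduct⁻ (members a) (members b) xy∈)

  Invariant : ℕ → Set
  Invariant n = properSum φℕ n < n × MultiplicativeAt φℕ n

  Below : ℕ → Set
  Below n = ∀ {m} → 1 ≤ m → m < n → Invariant m

  module CoprimeStep (reflexive : ReflexiveUpTo n) (below : Below n)
                     (ab≡n : a * b ≡ n) (1<a : 1 < a) (1<b : 1 < b) (coprime : Coprime a b) where

    1≤a : 1 ≤ a
    1≤a = <⇒≤ 1<a

    1≤b : 1 ≤ b
    1≤b = <⇒≤ 1<b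

    a<n : a < n
    a<n = proj₁ (factors< ab≡n 1<a 1<b)

    b<n : b < n
    b<n = proj₂ (factors< ab≡n 1<a 1<b)

    sum-φℕ-members< : 1 ≤ m → m < n → sum (map φℕ (members m)) ≡ m
    sum-φℕ-members< 1≤m m<n =
      sum-φℕ-members 1≤m (reflexive 1≤m (<⇒≤ m<n)) (<⇒≤ (proj₁ (below 1≤m m<n)))

    -- φℕ corrected at n so that it is multiplicative on all of A(a) × A(b), the pair (a, b) included.
    φ′ : ℕ → ℕ
    φ′ = φℕ [ n ≔ φℕ a * φℕ b ]

    φ′≡φℕ : d < n → φ′ d ≡ φℕ d
    φ′≡φℕ d<n = update-≢ φℕ _ (<⇒≢ d<n)

    sum-φ′≡sum-φℕ : m < n → sum (map φ′ (members m)) ≡ sum (map φℕ (members m))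
    sum-φ′≡sum-φℕ {m} m<n =
      cong sum (map-cong-local (All.tabulate λ d∈ → φ′≡φℕ (≤-<-trans (∈-members⇒≤ {m} d∈) m<n)))

    φ′-* : x ∈ members a → y ∈ members b → φ′ (x * y) ≡ φ′ x * φ′ y
    φ′-* {x} {y} x∈ y∈ with x * y ≟ n
    ... | yes xy≡n = begin
      φ′ (x * y)      ≡⟨ cong φ′ xy≡n ⟩
      φ′ n            ≡⟨ update-≡ φℕ n _ ⟩
      φℕ a * φℕ b     ≡⟨ cong₂ _*_ (φ′≡φℕ a<n) (φ′≡φℕ b<n) ⟨
      φ′ a * φ′ b     ≡⟨ uncurry (cong₂ λ u v → φ′ u * φ′ v) x≡a×y≡b ⟨
      φ′ x * φ′ y     ∎
      where
      open ≡-Reasoning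
      x≡a×y≡b : x ≡ a × y ≡ b
      x≡a×y≡b = coprimeFactors-unique coprime (∈-members⇒∣ 1≤a x∈) (∈-members⇒∣ 1≤b y∈) ∣-refl ∣-refl
                                      (trans xy≡n (sym ab≡n))
    ... | no xy≢n = begin
      φ′ (x * y)      ≡⟨ φ′≡φℕ xy<n ⟩
      φℕ (x * y)      ≡⟨ proj₂ (below (*-mono-≤ (∣⇒>0 1≤a x∣a) (∣⇒>0 1≤b y∣b)) xy<n) refl
                                   (coprime-divisors coprime x∣a y∣b) ⟩
      φℕ x * φℕ y     ≡⟨ cong₂ _*_ (φ′≡φℕ (≤-<-trans x≤a a<n)) (φ′≡φℕ (≤-<-trans y≤b b<n)) ⟨
      φ′ x * φ′ y     ∎
      where
      open ≡-Reasoning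
      x∣a : x ∣ a
      x∣a = ∈-members⇒∣ 1≤a x∈
      y∣b : y ∣ b
      y∣b = ∈-members⇒∣ 1≤b y∈
      x≤a : x ≤ a
      x≤a = ∈-members⇒≤ {a} x∈
      y≤b : y ≤ b
      y≤b = ∈-members⇒≤ {b} y∈
      xy<n : x * y < n
      xy<n = ≤∧≢⇒< (subst (x * y ≤_) ab≡n (*-mono-≤ x≤a y≤b)) xy≢n

    properSum+φℕa*φℕb : properSum φℕ n + φℕ a * φℕ b ≡ n
    properSum+φℕa*φℕb = begin
      properSum φℕ n + φℕ a * φℕ b                         ≡⟨ +-comm (properSum φℕ n) _ ⟩
      φℕ a * φℕ b + properSum φℕ n                         ≡⟨ cong₂ _+_ (update-≡ φℕ n _) (properSum-cong n φ′≡φℕ) ⟨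
      φ′ n + properSum φ′ n                                ≡⟨ cong (sum ∘ map φ′) (members-split 1≤n (reflexive 1≤n ≤-refl)) ⟨
      sum (map φ′ (members n))                             ≡⟨ cong (sum ∘ map φ′ ∘ members) ab≡n ⟨
      sum (map φ′ (members (a * b)))                       ≡⟨ sum-members-* 1≤a 1≤b coprime φ′ φ′-* ⟩
      sum (map φ′ (members a)) * sum (map φ′ (members b))  ≡⟨ cong₂ _*_ (sum-φ′≡sum-φℕ a<n) (sum-φ′≡sum-φℕ b<n) ⟩
      sum (map φℕ (members a)) * sum (map φℕ (members b))  ≡⟨ cong₂ _*_ (sum-φℕ-members< 1≤a a<n) (sum-φℕ-members< 1≤b b<n) ⟩
      a * b                                                ≡⟨ ab≡n ⟩
      n                                                    ∎
      where
      open ≡-Reasoning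
      1≤n : 1 ≤ n
      1≤n = subst (1 ≤_) ab≡n (*-mono-≤ 1≤a 1≤b)

  φℕ-multiplicativeAt : ReflexiveUpTo n → Below n → MultiplicativeAt φℕ n
  φℕ-multiplicativeAt _ _ {0} {b} refl _ = refl
  φℕ-multiplicativeAt _ _ {a} {0} refl _ = trans (cong φℕ (*-zeroʳ a)) (sym (*-zeroʳ (φℕ a)))
  φℕ-multiplicativeAt _ _ {1} {b} refl _ = trans (cong φℕ (*-identityˡ b)) (sym (*-identityˡ (φℕ b)))
  φℕ-multiplicativeAt _ _ {a} {1} refl _ = trans (cong φℕ (*-identityʳ a)) (sym (*-identityʳ (φℕ a)))
  φℕ-multiplicativeAt reflexive below {a@(2+ _)} {b@(2+ _)} refl coprime = begin
    φℕ (a * b)                                     ≡⟨ φℕ-unfold (a * b) ⟩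
    a * b ∸ S                                      ≡⟨ cong (_∸ S) (CoprimeStep.properSum+φℕa*φℕb reflexive below refl
                                                                     (s≤s (s≤s z≤n)) (s≤s (s≤s z≤n)) coprime) ⟨
    S + φℕ a * φℕ b ∸ S                            ≡⟨ m+n∸m≡n S _ ⟩
    φℕ a * φℕ b                                    ∎
    where
    open ≡-Reasoning
    S : ℕ
    S = properSum φℕ (a * b)

  properSum< : ReflexiveUpTo n → Below n → 1 ≤ n → properSum φℕ n < n
  properSum< {1} _ _ _ = s≤s z≤n
  properSum< {n@(2+ _)} reflexive below 1≤n with divisorChain⊎coprimeSplit (s≤s (s≤s z≤n))
  ... | inj₁ chain = properSum<-divisorChain 1≤n chain
  ... | inj₂ (a , b , 1<a , 1<b , ab≡n , coprime) = begin-strict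
    properSum φℕ n                <⟨ m<m+n (properSum φℕ n) (*-mono-≤ (φℕ>0 (proj₁ (below 1≤a a<n)))
                                                                      (φℕ>0 (proj₁ (below 1≤b b<n)))) ⟩
    properSum φℕ n + φℕ a * φℕ b  ≡⟨ properSum+φℕa*φℕb ⟩
    n                             ∎
    where
    open ≤-Reasoning
    open CoprimeStep reflexive below ab≡n 1<a 1<b coprime

  invariant : ∀ n → ReflexiveUpTo n → 1 ≤ n → Invariant n
  invariant = <-rec (λ n → ReflexiveUpTo n → 1 ≤ n → Invariant n) λ n rec reflexive 1≤n →
    let below : Below n
        below 1≤m m<n = rec m<n (UpTo-≤ (<⇒≤ m<n) reflexive) 1≤m
    in properSum< reflexive below 1≤n , φℕ-multiplicativeAt reflexive below

  1∈A[1] : T (mem A 1 1)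
  1∈A[1] with nonempty
  ... | n , d , 1≤n , d∈A
    with mult⇒ 1 n d ≤-refl 1≤n (λ (e∣1 , _) → ∣1⇒≡1 e∣1) (subst (λ m → T (mem A m d)) (sym (*-identityˡ n)) d∈A)
  ...   | d₁ , _ , d₁∈A , _ = subst (T ∘ mem A 1) (∣1⇒≡1 (memDiv A 1 d₁ ≤-refl d₁∈A)) d₁∈A

module InRing {c ℓ : Level} (R : CommutativeRing c ℓ) (A : DivisorSystem) where
  private module R = CommutativeRing R
  open R using (Carrier; _≈_; 1#)
  open import Algebra.Properties.Semiring.Mult R.semiring using (×1-homo-*) renaming (_×_ to _×ᴿ_)
  open import Algebra.Properties.Monoid.Mult R.+-monoid using (×-homo-+)
  open import Algebra.Properties.AbelianGroup R.+-abelianGroup using (∙-cancelˡ)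
  open import Relation.Binary.Reasoning.Setoid R.setoid
  open Members A

  ι≡×1# : ∀ n → ι R n ≡ n ×ᴿ 1#
  ι≡×1# zero    = refl
  ι≡×1# (suc n) = cong (1# R.+_) (ι≡×1# n)

  ι-+ : ∀ m n → ι R (m + n) ≈ ι R m R.+ ι R n
  ι-+ m n rewrite ι≡×1# (m + n) | ι≡×1# m | ι≡×1# n = ×-homo-+ 1# m n

  ι-* : ∀ m n → ι R (m * n) ≈ ι R m R.* ι R n
  ι-* m n rewrite ι≡×1# (m * n) | ι≡×1# m | ι≡×1# n = ×1-homo-* m n

  partialSum-ι : ∀ h n k → partialSum R A (ι R ∘ h) n k ≈ ι R (sum (map h (membersUpTo n k)))
  partialSum-ι h n zero    = R.refl
  partialSum-ι h n (suc k) with mem A n (suc k)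
  ... | true  = R.trans (R.trans (R.+-congʳ (partialSum-ι h n k)) (R.+-comm _ _)) (R.sym (ι-+ (h (suc k)) _))
  ... | false = R.trans (R.+-identityʳ _) (partialSum-ι h n k)

  partialSum-cong : ∀ {φ ψ} n k → (∀ {d} → 1 ≤ d → d ≤ k → φ d ≈ ψ d) →
                    partialSum R A φ n k ≈ partialSum R A ψ n k
  partialSum-cong n zero    φ≈ψ = R.refl
  partialSum-cong n (suc k) φ≈ψ with mem A n (suc k)
  ... | true  = R.+-cong (partialSum-cong n k λ 1≤d d≤k → φ≈ψ 1≤d (m≤n⇒m≤1+n d≤k)) (φ≈ψ (s≤s z≤n) ≤-refl)
  ... | false = R.+-congʳ (partialSum-cong n k λ 1≤d d≤k → φ≈ψ 1≤d (m≤n⇒m≤1+n d≤k))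

  divisorSum-∈ : ∀ φ n → T (mem A (suc n) (suc n)) →
                 divisorSum R A φ (suc n) ≈ partialSum R A φ (suc n) n R.+ φ (suc n)
  divisorSum-∈ φ n n∈A with mem A (suc n) (suc n)
  ... | true = R.refl

  divisorSum-∉ : ∀ φ n → mem A (suc n) (suc n) ≡ false →
                 divisorSum R A φ (suc n) ≈ partialSum R A φ (suc n) n
  divisorSum-∉ φ n n∉A rewrite n∉A = R.+-identityʳ _

  SolvesUpTo : (ℕ → Carrier) → ℕ → Set ℓ
  SolvesUpTo φ = UpTo λ m → divisorSum R A φ m ≈ ι R m

  solutions-agree : ∀ {φ ψ} n → ReflexiveUpTo n → SolvesUpTo φ n → SolvesUpTo ψ n → 1 ≤ n → φ n ≈ ψ n
  solutions-agree {φ} {ψ} = <-rec _ step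
    where
    step : ∀ n → (∀ {m} → m < n → ReflexiveUpTo m → SolvesUpTo φ m → SolvesUpTo ψ m → 1 ≤ m → φ m ≈ ψ m) →
           ReflexiveUpTo n → SolvesUpTo φ n → SolvesUpTo ψ n → 1 ≤ n → φ n ≈ ψ n
    step (suc n) rec reflexive φ-solves ψ-solves 1≤n = ∙-cancelˡ (partialSum R A φ (suc n) n) _ _ (begin
      partialSum R A φ (suc n) n R.+ φ (suc n)  ≈⟨ divisorSum-∈ φ n n∈A ⟨
      divisorSum R A φ (suc n)                  ≈⟨ φ-solves 1≤n ≤-refl ⟩
      ι R (suc n)                               ≈⟨ ψ-solves 1≤n ≤-refl ⟨
      divisorSum R A ψ (suc n)                  ≈⟨ divisorSum-∈ ψ n n∈A ⟩
      partialSum R A ψ (suc n) n R.+ ψ (suc n)  ≈⟨ R.+-congʳ (partialSum-cong (suc n) n φ≈ψ) ⟨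
      partialSum R A φ (suc n) n R.+ ψ (suc n)  ∎)
      where
      n∈A : T (mem A (suc n) (suc n))
      n∈A = reflexive 1≤n ≤-refl
      φ≈ψ : ∀ {d} → 1 ≤ d → d ≤ n → φ d ≈ ψ d
      φ≈ψ 1≤d d≤n = let d≤1+n = m≤n⇒m≤1+n d≤n in
        rec (s≤s d≤n) (UpTo-≤ d≤1+n reflexive) (UpTo-≤ d≤1+n φ-solves) (UpTo-≤ d≤1+n ψ-solves) 1≤d

module Solutions {c ℓ : Level} (R : CommutativeRing c ℓ) (A : DivisorSystem) (MA : IsMultiplicativeDS A) where
  private module R = CommutativeRing R
  open R using (_≈_; 1#)
  open import Relation.Binary.Reasoning.Setoid R.setoid
  open Members A
  open Candidate A
  open Multiplicative A MA
  open IsMultiplicativeDS MA using (mult⇐)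
  open InRing R A

  ιφℕ-solves : ∀ n → ReflexiveUpTo n → SolvesUpTo (ι R ∘ φℕ) n
  ιφℕ-solves n reflexive {m} 1≤m m≤n = R.trans (partialSum-ι φℕ m m) (R.reflexive (cong (ι R) sum≡m))
    where
    sum≡m : sum (map φℕ (members m)) ≡ m
    sum≡m = sum-φℕ-members 1≤m (reflexive 1≤m m≤n) (<⇒≤ (proj₁ (invariant m (UpTo-≤ m≤n reflexive) 1≤m)))

  solution≈ιφℕ : ∀ {φ} → IsSolution R A φ → ∀ n → ReflexiveUpTo n → 1 ≤ n → φ n ≈ ι R (φℕ n)
  solution≈ιφℕ sol n reflexive = solutions-agree n reflexive (λ 1≤m _ → sol _ 1≤m) (ιφℕ-solves n reflexive)

  solution⇒reflexive : CharZero R → ∀ {φ} → IsSolution R A φ → Reflexive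
  solution⇒reflexive charZero {φ} sol = <-rec _ step
    where
    step : ∀ n → (∀ {m} → m < n → 1 ≤ m → T (mem A m m)) → 1 ≤ n → T (mem A n n)
    step 1 _ _ = 1∈A[1]
    step n@(2+ k) rec _ with divisorChain⊎coprimeSplit (s≤s (s≤s z≤n))
    ... | inj₂ (a , b , 1<a , 1<b , ab≡n , coprime) =
      let a<n , b<n = factors< ab≡n 1<a 1<b
          1≤a , 1≤b = <⇒≤ 1<a , <⇒≤ 1<b
      in subst (λ m → T (mem A m m)) ab≡n (mult⇐ a b a b 1≤a 1≤b coprime (rec a<n 1≤a) (rec b<n 1≤b))
    ... | inj₁ chain with mem A n n in n∉A
    ...   | true  = tt
    ...   | false = contradiction (charZero _ _ proper≈n) (<⇒≢ (properSum<-divisorChain (s≤s z≤n) chain))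
      where
      φ≈ιφℕ : ∀ {d} → 1 ≤ d → d ≤ suc k → φ d ≈ ι R (φℕ d)
      φ≈ιφℕ 1≤d d≤1+k = solution≈ιφℕ sol _ (λ 1≤m m≤d → rec (s≤s (≤-trans m≤d d≤1+k)) 1≤m) 1≤d
      proper≈n : ι R (properSum φℕ n) ≈ ι R n
      proper≈n = begin
        ι R (properSum φℕ n)                 ≈⟨ partialSum-ι φℕ n (suc k) ⟨
        partialSum R A (ι R ∘ φℕ) n (suc k)  ≈⟨ partialSum-cong n (suc k) φ≈ιφℕ ⟨
        partialSum R A φ n (suc k)           ≈⟨ divisorSum-∉ φ (suc k) n∉A ⟨
        divisorSum R A φ n                   ≈⟨ sol n (s≤s z≤n) ⟩
        ι R n                                ∎

  module _ (reflexive : Reflexive) where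

    reflexiveUpTo : ∀ n → ReflexiveUpTo n
    reflexiveUpTo n 1≤m _ = reflexive _ 1≤m

    ιφℕ-solution : IsSolution R A (ι R ∘ φℕ)
    ιφℕ-solution n 1≤n = ιφℕ-solves n (reflexiveUpTo n) 1≤n ≤-refl

    module _ {φ} (sol : IsSolution R A φ) where

      private
        φ≈ιφℕ : ∀ n → 1 ≤ n → φ n ≈ ι R (φℕ n)
        φ≈ιφℕ n = solution≈ιφℕ sol n (reflexiveUpTo n)

      solution-unique : ∀ ψ → IsSolution R A ψ → ∀ n → 1 ≤ n → ψ n ≈ φ n
      solution-unique ψ ψ-sol n 1≤n = R.trans (solution≈ιφℕ ψ-sol n (reflexiveUpTo n) 1≤n) (R.sym (φ≈ιφℕ n 1≤n))

      solution-multiplicative : IsMultiplicativeFn R φ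
      solution-multiplicative = R.trans (φ≈ιφℕ 1 ≤-refl) (R.+-identityʳ 1#) , φ-*
        where
        φ-* : ∀ m n → 1 ≤ m → 1 ≤ n → Coprime m n → φ (m * n) ≈ φ m R.* φ n
        φ-* m n 1≤m 1≤n coprime = begin
          φ (m * n)                    ≈⟨ φ≈ιφℕ (m * n) 1≤mn ⟩
          ι R (φℕ (m * n))             ≡⟨ cong (ι R) (proj₂ (invariant (m * n) (reflexiveUpTo _) 1≤mn) refl coprime) ⟩
          ι R (φℕ m * φℕ n)            ≈⟨ ι-* (φℕ m) (φℕ n) ⟩
          ι R (φℕ m) R.* ι R (φℕ n)    ≈⟨ R.*-cong (φ≈ιφℕ m 1≤m) (φ≈ιφℕ n 1≤n) ⟨
          φ m R.* φ n                  ∎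
          where
          1≤mn : 1 ≤ m * n
          1≤mn = *-mono-≤ 1≤m 1≤n

      solution-bounds : ∀ n → 1 ≤ n → Σ ℕ λ m → 1 ≤ m × m ≤ n × φ n ≈ ι R m
      solution-bounds n 1≤n =
        φℕ n , φℕ>0 (proj₁ (invariant n (reflexiveUpTo n) 1≤n)) , φℕ≤id n , φ≈ιφℕ n 1≤n

theorem5 : {c ℓ : Level} (R : CommutativeRing c ℓ) → CharZero R →
           (A : DivisorSystem) → IsMultiplicativeDS A →
           (((Σ (ℕ → CommutativeRing.Carrier R) λ φ → IsSolution R A φ) →
               ∀ n → 1 ≤ n → T (mem A n n))
            × ((∀ n → 1 ≤ n → T (mem A n n)) →
               Σ (ℕ → CommutativeRing.Carrier R) λ φ → IsSolution R A φ))
           × (∀ φ → IsSolution R A φ →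
                (∀ ψ → IsSolution R A ψ → ∀ n → 1 ≤ n → CommutativeRing._≈_ R (ψ n) (φ n))
                × IsMultiplicativeFn R φ
                × (∀ n → 1 ≤ n → Σ ℕ λ m → 1 ≤ m × m ≤ n × CommutativeRing._≈_ R (φ n) (ι R m)))
theorem5 R charZero A MA =
  ( (λ (_ , sol) → solution⇒reflexive charZero sol)
  , (λ reflexive → ι R ∘ φℕ , ιφℕ-solution reflexive) )
  , λ φ sol → let reflexive = solution⇒reflexive charZero sol in
      solution-unique reflexive sol , solution-multiplicative reflexive sol , solution-bounds reflexive sol
  where
  open Candidate A using (φℕ)
  open Solutions R A MA
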